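{- Let $\Gamma_0(f)=\{\begin{pmatrix}a&b\\ c&d\end{pmatrix}\in\mathrm{GL}_2(\mathbb{F}_2[\mathbf{t}]): c\equiv0 \pmod f\}$. Then $\Gamma_0(\mathbf{t}^2)$ is a normal subgroup of index $2$ in $\Gamma_0(\mathbf{t})$. -}

module Defs where

open import Data.Bool using (Bool; true; false; _xor_)
open import Data.List using (List; []; _∷_)
open import Data.List.Relation.Unary.All using (All)
open import Data.Product using (Σ; _×_; _,_; ∃)
open import Data.Fin using (Fin)
open import Data.Nat using (ℕ)
open import Relation.Binary.PropositionalEquality using (_≡_)
open import Function.Bundles using (_⇔_)

-- The polynomial ring F₂[t]: coefficient lists (constant term first),
-- compared up to trailing zero coefficients.

Poly : Set
Poly = List Bool

infixl 6 _+ₚ_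
infixl 7 _*ₚ_ _·_

_+ₚ_ : Poly → Poly → Poly
[] +ₚ q = q
(a ∷ p) +ₚ [] = a ∷ p
(a ∷ p) +ₚ (b ∷ q) = (a xor b) ∷ (p +ₚ q)

_·_ : Bool → Poly → Poly
true · q = q
false · q = []

_*ₚ_ : Poly → Poly → Poly
[] *ₚ q = []
(a ∷ p) *ₚ q = (a · q) +ₚ (false ∷ (p *ₚ q))

IsZero : Poly → Set
IsZero p = All (_≡ false) p

-- equality in F₂[t]  (p = q  iff  p - q = p + q = 0)
infix 4 _≈ₚ_
_≈ₚ_ : Poly → Poly → Set
p ≈ₚ q = IsZero (p +ₚ q)

0ₚ 1ₚ 𝐭 : Poly
0ₚ = []
1ₚ = true ∷ []
𝐭 = false ∷ true ∷ []

_∣ₚ_ : Poly → Poly → Set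
f ∣ₚ c = ∃ λ q → c ≈ₚ q *ₚ f

record M2 : Set where
  constructor mat
  field a b c d : Poly
open M2 public

infixl 7 _⊗_
_⊗_ : M2 → M2 → M2
mat a₁ b₁ c₁ d₁ ⊗ mat a₂ b₂ c₂ d₂ =
  mat (a₁ *ₚ a₂ +ₚ b₁ *ₚ c₂) (a₁ *ₚ b₂ +ₚ b₁ *ₚ d₂)
      (c₁ *ₚ a₂ +ₚ d₁ *ₚ c₂) (c₁ *ₚ b₂ +ₚ d₁ *ₚ d₂)

I₂ : M2
I₂ = mat 1ₚ 0ₚ 0ₚ 1ₚ

infix 4 _≈ₘ_
_≈ₘ_ : M2 → M2 → Set
M ≈ₘ N = (a M ≈ₚ a N) × (b M ≈ₚ b N) × (c M ≈ₚ c N) × (d M ≈ₚ d N)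

record GL2 : Set where
  constructor gl
  field
    mat⁺ : M2
    mat⁻ : M2
    invʳ : mat⁺ ⊗ mat⁻ ≈ₘ I₂
    invˡ : mat⁻ ⊗ mat⁺ ≈ₘ I₂
open GL2 public

-- Γ₀(f) = { g ∈ GL₂(F₂[t]) : c ≡ 0 mod f }: g ∈ Γ₀(f) iff ΓM₀ f (mat⁺ g) (defined below).

-- group operations of GL₂ expressed on the underlying matrices
-- (g·h has matrix mat⁺ g ⊗ mat⁺ h, g⁻¹ has matrix mat⁻ g).

IsSubgroupOfGL2 : (M2 → Set) → Set
IsSubgroupOfGL2 H =
  H I₂ ×
  (∀ (g h : GL2) → H (mat⁺ g) → H (mat⁺ h) → H (mat⁺ g ⊗ mat⁺ h)) ×
  (∀ (g : GL2) → H (mat⁺ g) → H (mat⁻ g))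

IsNormalIn : (M2 → Set) → (M2 → Set) → Set
IsNormalIn H G =
  (∀ (g : GL2) → H (mat⁺ g) → G (mat⁺ g)) ×
  (∀ (g h : GL2) → G (mat⁺ g) → H (mat⁺ h) → H (mat⁺ g ⊗ mat⁺ h ⊗ mat⁻ g))

-- [G : H] = n : the left cosets gH (g ∈ G) are in bijection with Fin n,
-- i.e. there is a map φ on G with φ g ≡ φ g' ⇔ g⁻¹g' ∈ H, onto Fin n.
HasIndex : (M2 → Set) → (M2 → Set) → ℕ → Set
HasIndex H G n =
  Σ (GL2 → Fin n) λ φ →
    (∀ (g g' : GL2) → G (mat⁺ g) → G (mat⁺ g') →
       (φ g ≡ φ g') ⇔ H (mat⁻ g ⊗ mat⁺ g')) ×
    (∀ (i : Fin n) → ∃ λ (g : GL2) → G (mat⁺ g) × φ g ≡ i)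

ΓM₀ : Poly → M2 → Set
ΓM₀ f M = f ∣ₚ c M

{-# OPTIONS --safe #-}
-- Reduce modulo t², i.e. pass to matrices over F₂[ε] = F₂[t]/(t²).  Since the only unit of
-- F₂ is 1, every g ∈ Γ₀(t) is upper unitriangular modulo ε.  For two such matrices the
-- lower-left entry of the product is c₁ a₂ + d₁ c₂ = c₁ + c₂, because c₁, c₂ ∈ εF₂[ε] and
-- a₂, d₁ ∈ 1 + εF₂[ε].  So χ(g) := the ε-coefficient of c(g) is a homomorphism Γ₀(t) → ℤ/2,
-- onto (take [[1,0],[t,1]]) and with kernel Γ₀(t²), which is therefore normal of index 2.
module Submission where

open import Defs
open import Data.Bool using (Bool; true; false; not; _xor_; _∧_)
open import Data.Bool.Properties using (xor-identityʳ; xor-same; ∧-identityʳ; ∧-zeroʳ)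
open import Data.List using ([]; _∷_; _++_; replicate; drop)
open import Data.List.Relation.Unary.All using ([]; _∷_)
open import Data.Nat using (ℕ; zero; suc; _<_; z<s; s<s)
open import Data.Fin using (Fin)
open import Data.Fin.Properties using (2↔Bool)
open import Data.Product using (_×_; _,_; proj₁; proj₂; ∃)
open import Function using (_∘_)
open import Function.Bundles using (_⇔_; mk⇔; Equivalence; _↔_; Inverse)
open import Relation.Binary.PropositionalEquality
  using (_≡_; refl; sym; trans; cong; cong₂; subst; module ≡-Reasoning)

open Equivalence using (to; from)
open ≡-Reasoning

xor≡false⇔≡ : ∀ {x y} → x xor y ≡ false ⇔ x ≡ y
xor≡false⇔≡ {x} = mk⇔ (cancel _ _) λ { refl → xor-same x }
  where
  cancel : ∀ x y → x xor y ≡ false → x ≡ y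
  cancel false false _ = refl
  cancel true  true  _ = refl

coeff : ℕ → Poly → Bool
coeff n       []      = false
coeff zero    (x ∷ p) = x
coeff (suc n) (x ∷ p) = coeff n p

coeff-+ₚ : ∀ n p q → coeff n (p +ₚ q) ≡ coeff n p xor coeff n q
coeff-+ₚ n       []      q       = refl
coeff-+ₚ n       (x ∷ p) []      = sym (xor-identityʳ _)
coeff-+ₚ zero    (x ∷ p) (y ∷ q) = refl
coeff-+ₚ (suc n) (x ∷ p) (y ∷ q) = coeff-+ₚ n p q

IsZero⇔coeff≡false : ∀ {p} → IsZero p ⇔ (∀ n → coeff n p ≡ false)
IsZero⇔coeff≡false = mk⇔ ⇒coeff coeff⇒
  where
  ⇒coeff : ∀ {p} → IsZero p → ∀ n → coeff n p ≡ false
  ⇒coeff []       n       = refl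
  ⇒coeff (x ∷ _)  zero    = x
  ⇒coeff (_ ∷ xs) (suc n) = ⇒coeff xs n
  coeff⇒ : ∀ {p} → (∀ n → coeff n p ≡ false) → IsZero p
  coeff⇒ {[]}    _ = []
  coeff⇒ {_ ∷ p} h = h zero ∷ coeff⇒ (h ∘ suc)

≈ₚ⇔coeff≡ : ∀ p q → p ≈ₚ q ⇔ (∀ n → coeff n p ≡ coeff n q)
≈ₚ⇔coeff≡ p q = mk⇔
  (λ e n → to xor≡false⇔≡ (trans (sym (coeff-+ₚ n p q)) (to IsZero⇔coeff≡false e n)))
  (λ h → from IsZero⇔coeff≡false λ n → trans (coeff-+ₚ n p q) (from xor≡false⇔≡ (h n)))

coeff-*ₚ-1ₚ : ∀ p n → coeff n (p *ₚ 1ₚ) ≡ coeff n p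
coeff-*ₚ-1ₚ []          n       = refl
coeff-*ₚ-1ₚ (false ∷ p) zero    = refl
coeff-*ₚ-1ₚ (true  ∷ p) zero    = refl
coeff-*ₚ-1ₚ (false ∷ p) (suc n) = coeff-*ₚ-1ₚ p n
coeff-*ₚ-1ₚ (true  ∷ p) (suc n) = coeff-*ₚ-1ₚ p n

coeff-*ₚ-shift : ∀ p q n → coeff n (p *ₚ (false ∷ q)) ≡ coeff n (false ∷ p *ₚ q)
coeff-*ₚ-shift []          q zero    = refl
coeff-*ₚ-shift []          q (suc n) = refl
coeff-*ₚ-shift (false ∷ p) q zero    = refl
coeff-*ₚ-shift (false ∷ p) q (suc n) = coeff-*ₚ-shift p q n
coeff-*ₚ-shift (true  ∷ p) q zero    = refl
coeff-*ₚ-shift (true  ∷ p) q (suc n) = begin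
  coeff n (q +ₚ p *ₚ (false ∷ q))          ≡⟨ coeff-+ₚ n q _ ⟩
  coeff n q xor coeff n (p *ₚ (false ∷ q)) ≡⟨ cong (coeff n q xor_) (coeff-*ₚ-shift p q n) ⟩
  coeff n q xor coeff n (false ∷ p *ₚ q)   ≡⟨ coeff-+ₚ n q _ ⟨
  coeff n (q +ₚ (false ∷ p *ₚ q))          ∎

-- 𝐭 and 𝐭 *ₚ 𝐭 compute to 𝐭^ 1 and 𝐭^ 2.
𝐭^ : ℕ → Poly
𝐭^ k = replicate k false ++ 1ₚ

coeff-*ₚ-𝐭^ : ∀ k p n → coeff n (p *ₚ 𝐭^ k) ≡ coeff n (replicate k false ++ p)
coeff-*ₚ-𝐭^ zero    p n       = coeff-*ₚ-1ₚ p n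
coeff-*ₚ-𝐭^ (suc k) p zero    = coeff-*ₚ-shift p (𝐭^ k) zero
coeff-*ₚ-𝐭^ (suc k) p (suc n) = trans (coeff-*ₚ-shift p (𝐭^ k) (suc n)) (coeff-*ₚ-𝐭^ k p n)

coeff-replicate-false-++ : ∀ k p {n} → n < k → coeff n (replicate k false ++ p) ≡ false
coeff-replicate-false-++ (suc k) p {zero}  z<s       = refl
coeff-replicate-false-++ (suc k) p {suc n} (s<s n<k) = coeff-replicate-false-++ k p n<k

coeff≡replicate-false-++-drop : ∀ k p → (∀ n → n < k → coeff n p ≡ false) →
                          ∀ n → coeff n p ≡ coeff n (replicate k false ++ drop k p)
coeff≡replicate-false-++-drop zero    p       _ n       = refl
coeff≡replicate-false-++-drop (suc k) []      _ n       = coeff-*ₚ-𝐭^ (suc k) [] n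
coeff≡replicate-false-++-drop (suc k) (x ∷ p) h zero    = h zero z<s
coeff≡replicate-false-++-drop (suc k) (x ∷ p) h (suc n) =
  coeff≡replicate-false-++-drop k p (λ m m<k → h (suc m) (s<s m<k)) n

𝐭^∣ₚ⇔ : ∀ k p → 𝐭^ k ∣ₚ p ⇔ (∀ n → n < k → coeff n p ≡ false)
𝐭^∣ₚ⇔ k p = mk⇔
  (λ { (q , e) n n<k → begin
         coeff n p                        ≡⟨ to (≈ₚ⇔coeff≡ p _) e n ⟩
         coeff n (q *ₚ 𝐭^ k)              ≡⟨ coeff-*ₚ-𝐭^ k q n ⟩
         coeff n (replicate k false ++ q) ≡⟨ coeff-replicate-false-++ k q n<k ⟩
         false                            ∎ })
  (λ h → drop k p , from (≈ₚ⇔coeff≡ p _) λ n →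
     trans (coeff≡replicate-false-++-drop k p h n) (sym (coeff-*ₚ-𝐭^ k (drop k p) n)))

𝐭∣ₚ⇔ : ∀ p → 𝐭 ∣ₚ p ⇔ coeff 0 p ≡ false
𝐭∣ₚ⇔ p = mk⇔ (λ h → to (𝐭^∣ₚ⇔ 1 p) h 0 z<s) (λ h → from (𝐭^∣ₚ⇔ 1 p) λ { 0 z<s → h })

𝐭²∣ₚ⇔ : ∀ p → (𝐭 *ₚ 𝐭) ∣ₚ p ⇔ (coeff 0 p ≡ false × coeff 1 p ≡ false)
𝐭²∣ₚ⇔ p = mk⇔ (λ h → to (𝐭^∣ₚ⇔ 2 p) h 0 z<s , to (𝐭^∣ₚ⇔ 2 p) h 1 (s<s z<s))
            (λ { (h₀ , h₁) → from (𝐭^∣ₚ⇔ 2 p) λ { 0 z<s → h₀ ; 1 (s<s z<s) → h₁ } })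

-- F₂[t]/(t²) = F₂[ε], the pair (x₀ , x₁) standing for x₀ + x₁ε; jet is reduction mod t².
𝔻 : Set
𝔻 = Bool × Bool

infixl 6 _+𝔻_
infixl 7 _*𝔻_

_+𝔻_ : 𝔻 → 𝔻 → 𝔻
(x₀ , x₁) +𝔻 (y₀ , y₁) = x₀ xor y₀ , x₁ xor y₁

_*𝔻_ : 𝔻 → 𝔻 → 𝔻
(x₀ , x₁) *𝔻 (y₀ , y₁) = x₀ ∧ y₀ , (x₀ ∧ y₁) xor (x₁ ∧ y₀)

jet : Poly → 𝔻
jet p = coeff 0 p , coeff 1 p

jet-cong : ∀ p q → p ≈ₚ q → jet p ≡ jet q
jet-cong p q e = cong₂ _,_ (to (≈ₚ⇔coeff≡ p q) e 0) (to (≈ₚ⇔coeff≡ p q) e 1)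

jet-+ₚ : ∀ p q → jet (p +ₚ q) ≡ jet p +𝔻 jet q
jet-+ₚ p q = cong₂ _,_ (coeff-+ₚ 0 p q) (coeff-+ₚ 1 p q)

jet-*ₚ : ∀ p q → jet (p *ₚ q) ≡ jet p *𝔻 jet q
jet-*ₚ []          q = refl
jet-*ₚ (false ∷ p) q = cong (false ,_) (cong proj₁ (jet-*ₚ p q))
jet-*ₚ (true  ∷ p) q = begin
  jet (q +ₚ (false ∷ p *ₚ q))         ≡⟨ jet-+ₚ q _ ⟩
  jet q +𝔻 (false , coeff 0 (p *ₚ q)) ≡⟨ cong₂ _,_ (xor-identityʳ _)
                                                (cong (coeff 1 q xor_) (cong proj₁ (jet-*ₚ p q))) ⟩
  jet (true ∷ p) *𝔻 jet q             ∎

record M2𝔻 : Set where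
  constructor mat𝔻
  field a b c d : 𝔻
open M2𝔻

infixl 7 _⊗𝔻_
_⊗𝔻_ : M2𝔻 → M2𝔻 → M2𝔻
mat𝔻 a₁ b₁ c₁ d₁ ⊗𝔻 mat𝔻 a₂ b₂ c₂ d₂ =
  mat𝔻 (a₁ *𝔻 a₂ +𝔻 b₁ *𝔻 c₂) (a₁ *𝔻 b₂ +𝔻 b₁ *𝔻 d₂)
       (c₁ *𝔻 a₂ +𝔻 d₁ *𝔻 c₂) (c₁ *𝔻 b₂ +𝔻 d₁ *𝔻 d₂)

I𝔻 : M2𝔻
I𝔻 = mat𝔻 (true , false) (false , false) (false , false) (true , false)

jetₘ : M2 → M2𝔻
jetₘ (mat a b c d) = mat𝔻 (jet a) (jet b) (jet c) (jet d)

mat𝔻-cong : ∀ {a a′ b b′ c c′ d d′} → a ≡ a′ → b ≡ b′ → c ≡ c′ → d ≡ d′ →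
            mat𝔻 a b c d ≡ mat𝔻 a′ b′ c′ d′
mat𝔻-cong refl refl refl refl = refl

jetₘ-cong : ∀ M N → M ≈ₘ N → jetₘ M ≡ jetₘ N
jetₘ-cong (mat a b c d) (mat a′ b′ c′ d′) (ea , eb , ec , ed) =
  mat𝔻-cong (jet-cong a a′ ea) (jet-cong b b′ eb) (jet-cong c c′ ec) (jet-cong d d′ ed)

jetₘ-⊗ : ∀ M N → jetₘ (M ⊗ N) ≡ jetₘ M ⊗𝔻 jetₘ N
jetₘ-⊗ (mat a₁ b₁ c₁ d₁) (mat a₂ b₂ c₂ d₂) =
  mat𝔻-cong (jet-entry a₁ a₂ b₁ c₂) (jet-entry a₁ b₂ b₁ d₂)
            (jet-entry c₁ a₂ d₁ c₂) (jet-entry c₁ b₂ d₁ d₂)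
  where
  jet-entry : ∀ x y z w → jet (x *ₚ y +ₚ z *ₚ w) ≡ jet x *𝔻 jet y +𝔻 jet z *𝔻 jet w
  jet-entry x y z w = trans (jet-+ₚ (x *ₚ y) (z *ₚ w)) (cong₂ _+𝔻_ (jet-*ₚ x y) (jet-*ₚ z w))

record IsUnitriangularModε (A : M2𝔻) : Set where
  constructor unitriangular
  field
    a≡1 : proj₁ (a A) ≡ true
    c≡0 : proj₁ (c A) ≡ false
    d≡1 : proj₁ (d A) ≡ true

χ𝔻 : M2𝔻 → Bool
χ𝔻 A = proj₂ (c A)

unitriangular-⊗ : ∀ {A B} → IsUnitriangularModε A → IsUnitriangularModε B →
                  IsUnitriangularModε (A ⊗𝔻 B)
unitriangular-⊗ {mat𝔻 _ (b₀ , _) _ _} {mat𝔻 _ _ _ _}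
                (unitriangular refl refl refl) (unitriangular refl refl refl) =
  unitriangular (cong not (∧-zeroʳ b₀)) refl refl

χ𝔻-⊗ : ∀ {A B} → IsUnitriangularModε A → IsUnitriangularModε B → χ𝔻 (A ⊗𝔻 B) ≡ χ𝔻 A xor χ𝔻 B
χ𝔻-⊗ {mat𝔻 _ _ (_ , c₁) (_ , d₁)} {mat𝔻 _ _ (_ , c₁′) _}
     (unitriangular refl refl refl) (unitriangular refl refl refl) =
  cong₂ _xor_ (∧-identityʳ c₁) (trans (cong (c₁′ xor_) (∧-zeroʳ d₁)) (xor-identityʳ c₁′))

∧≡true⇒ : ∀ {x y} → x ∧ y ≡ true → x ≡ true × y ≡ true
∧≡true⇒ {true} {true} refl = refl , refl

-- Mod ε: d₀ d₀′ = 1 and a₀′ a₀ = 1 in F₂ force these to be 1, and then d₀ c₀′ = 0 gives c₀′ = 0.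
inverse-unitriangular : ∀ {A B} → proj₁ (c A) ≡ false → A ⊗𝔻 B ≡ I𝔻 → B ⊗𝔻 A ≡ I𝔻 →
                        IsUnitriangularModε A × IsUnitriangularModε B
inverse-unitriangular {mat𝔻 (a₀ , _) _ _ (d₀ , _)} {mat𝔻 (a₀′ , _) (b₀′ , _) _ (d₀′ , _)}
                      refl AB≡I BA≡I
  with ∧≡true⇒ {d₀} {d₀′} (cong (proj₁ ∘ d) AB≡I)
     | ∧≡true⇒ {a₀′} {a₀} (begin
         a₀′ ∧ a₀                     ≡⟨ xor-identityʳ _ ⟨
         (a₀′ ∧ a₀) xor false         ≡⟨ cong ((a₀′ ∧ a₀) xor_) (∧-zeroʳ b₀′) ⟨
         (a₀′ ∧ a₀) xor (b₀′ ∧ false) ≡⟨ cong (proj₁ ∘ a) BA≡I ⟩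
         true                         ∎)
... | refl , refl | refl , refl =
  unitriangular refl refl refl , unitriangular refl (cong (proj₁ ∘ c) AB≡I) refl

χ𝔻-inverse : ∀ {A B} → IsUnitriangularModε A → IsUnitriangularModε B → B ⊗𝔻 A ≡ I𝔻 → χ𝔻 B ≡ χ𝔻 A
χ𝔻-inverse A-uni B-uni BA≡I = to xor≡false⇔≡ (trans (sym (χ𝔻-⊗ B-uni A-uni)) (cong χ𝔻 BA≡I))

ΓM₁𝐭 : M2 → Set
ΓM₁𝐭 M = IsUnitriangularModε (jetₘ M)

χ : M2 → Bool
χ M = χ𝔻 (jetₘ M)

ΓM₁𝐭-⊗ : ∀ M N → ΓM₁𝐭 M → ΓM₁𝐭 N → ΓM₁𝐭 (M ⊗ N)
ΓM₁𝐭-⊗ M N M∈ N∈ = subst IsUnitriangularModε (sym (jetₘ-⊗ M N)) (unitriangular-⊗ M∈ N∈)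

χ-⊗ : ∀ M N → ΓM₁𝐭 M → ΓM₁𝐭 N → χ (M ⊗ N) ≡ χ M xor χ N
χ-⊗ M N M∈ N∈ = trans (cong χ𝔻 (jetₘ-⊗ M N)) (χ𝔻-⊗ M∈ N∈)

ΓM₁𝐭⇒ΓM₀𝐭 : ∀ M → ΓM₁𝐭 M → ΓM₀ 𝐭 M
ΓM₁𝐭⇒ΓM₀𝐭 M M∈ = from (𝐭∣ₚ⇔ (c M)) (IsUnitriangularModε.c≡0 M∈)

jetₘ-invʳ : ∀ g → jetₘ (mat⁺ g) ⊗𝔻 jetₘ (mat⁻ g) ≡ I𝔻
jetₘ-invʳ g = trans (sym (jetₘ-⊗ (mat⁺ g) (mat⁻ g))) (jetₘ-cong _ I₂ (invʳ g))

jetₘ-invˡ : ∀ g → jetₘ (mat⁻ g) ⊗𝔻 jetₘ (mat⁺ g) ≡ I𝔻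
jetₘ-invˡ g = trans (sym (jetₘ-⊗ (mat⁻ g) (mat⁺ g))) (jetₘ-cong _ I₂ (invˡ g))

ΓM₀𝐭⇒ΓM₁𝐭 : ∀ g → ΓM₀ 𝐭 (mat⁺ g) → ΓM₁𝐭 (mat⁺ g) × ΓM₁𝐭 (mat⁻ g)
ΓM₀𝐭⇒ΓM₁𝐭 g g∈ = inverse-unitriangular (to (𝐭∣ₚ⇔ (c (mat⁺ g))) g∈) (jetₘ-invʳ g) (jetₘ-invˡ g)

χ-inverse : ∀ g → ΓM₀ 𝐭 (mat⁺ g) → χ (mat⁻ g) ≡ χ (mat⁺ g)
χ-inverse g g∈ = χ𝔻-inverse (proj₁ (ΓM₀𝐭⇒ΓM₁𝐭 g g∈)) (proj₂ (ΓM₀𝐭⇒ΓM₁𝐭 g g∈)) (jetₘ-invˡ g)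

ΓM₀𝐭²⇔ : ∀ M → ΓM₀ (𝐭 *ₚ 𝐭) M ⇔ (ΓM₀ 𝐭 M × χ M ≡ false)
ΓM₀𝐭²⇔ M = mk⇔ (λ M∈ → let (c₀≡0 , c₁≡0) = to (𝐭²∣ₚ⇔ (c M)) M∈ in from (𝐭∣ₚ⇔ (c M)) c₀≡0 , c₁≡0)
               (λ (M∈ , χ≡0) → from (𝐭²∣ₚ⇔ (c M)) (to (𝐭∣ₚ⇔ (c M)) M∈ , χ≡0))

ΓM₀𝐭-⊗ : ∀ g h → ΓM₀ 𝐭 (mat⁺ g) → ΓM₀ 𝐭 (mat⁺ h) → ΓM₀ 𝐭 (mat⁺ g ⊗ mat⁺ h)
ΓM₀𝐭-⊗ g h g∈ h∈ = ΓM₁𝐭⇒ΓM₀𝐭 (mat⁺ g ⊗ mat⁺ h)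
  (ΓM₁𝐭-⊗ (mat⁺ g) (mat⁺ h) (proj₁ (ΓM₀𝐭⇒ΓM₁𝐭 g g∈)) (proj₁ (ΓM₀𝐭⇒ΓM₁𝐭 h h∈)))

ΓM₀𝐭-⁻¹ : ∀ g → ΓM₀ 𝐭 (mat⁺ g) → ΓM₀ 𝐭 (mat⁻ g)
ΓM₀𝐭-⁻¹ g g∈ = ΓM₁𝐭⇒ΓM₀𝐭 (mat⁻ g) (proj₂ (ΓM₀𝐭⇒ΓM₁𝐭 g g∈))

Γ₀𝐭-isSubgroup : IsSubgroupOfGL2 (ΓM₀ 𝐭)
Γ₀𝐭-isSubgroup = from (𝐭∣ₚ⇔ 0ₚ) refl , ΓM₀𝐭-⊗ , ΓM₀𝐭-⁻¹

Γ₀𝐭²-isSubgroup : IsSubgroupOfGL2 (ΓM₀ (𝐭 *ₚ 𝐭))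
Γ₀𝐭²-isSubgroup = from (𝐭²∣ₚ⇔ 0ₚ) (refl , refl) , closed-⊗ , closed-⁻¹
  where
  closed-⊗ : ∀ g h → ΓM₀ (𝐭 *ₚ 𝐭) (mat⁺ g) → ΓM₀ (𝐭 *ₚ 𝐭) (mat⁺ h) →
             ΓM₀ (𝐭 *ₚ 𝐭) (mat⁺ g ⊗ mat⁺ h)
  closed-⊗ g h g∈ h∈ with to (ΓM₀𝐭²⇔ (mat⁺ g)) g∈ | to (ΓM₀𝐭²⇔ (mat⁺ h)) h∈
  ... | g∈𝐭 , χg≡0 | h∈𝐭 , χh≡0 = from (ΓM₀𝐭²⇔ (mat⁺ g ⊗ mat⁺ h)) (ΓM₀𝐭-⊗ g h g∈𝐭 h∈𝐭 , χgh≡0)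
    where
    χgh≡0 : χ (mat⁺ g ⊗ mat⁺ h) ≡ false
    χgh≡0 = begin
      χ (mat⁺ g ⊗ mat⁺ h)       ≡⟨ χ-⊗ (mat⁺ g) (mat⁺ h) (proj₁ (ΓM₀𝐭⇒ΓM₁𝐭 g g∈𝐭))
                                                         (proj₁ (ΓM₀𝐭⇒ΓM₁𝐭 h h∈𝐭)) ⟩
      χ (mat⁺ g) xor χ (mat⁺ h) ≡⟨ cong₂ _xor_ χg≡0 χh≡0 ⟩
      false                     ∎
  closed-⁻¹ : ∀ g → ΓM₀ (𝐭 *ₚ 𝐭) (mat⁺ g) → ΓM₀ (𝐭 *ₚ 𝐭) (mat⁻ g)
  closed-⁻¹ g g∈ with to (ΓM₀𝐭²⇔ (mat⁺ g)) g∈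
  ... | g∈𝐭 , χg≡0 = from (ΓM₀𝐭²⇔ (mat⁻ g)) (ΓM₀𝐭-⁻¹ g g∈𝐭 , trans (χ-inverse g g∈𝐭) χg≡0)

Γ₀𝐭²-normal : IsNormalIn (ΓM₀ (𝐭 *ₚ 𝐭)) (ΓM₀ 𝐭)
Γ₀𝐭²-normal = (λ h h∈ → proj₁ (to (ΓM₀𝐭²⇔ (mat⁺ h)) h∈)) , conjugate
  where
  conjugate : ∀ g h → ΓM₀ 𝐭 (mat⁺ g) → ΓM₀ (𝐭 *ₚ 𝐭) (mat⁺ h) →
              ΓM₀ (𝐭 *ₚ 𝐭) (mat⁺ g ⊗ mat⁺ h ⊗ mat⁻ g)
  conjugate g h g∈ h∈ with to (ΓM₀𝐭²⇔ (mat⁺ h)) h∈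
  ... | h∈𝐭 , χh≡0 = from (ΓM₀𝐭²⇔ (M ⊗ K ⊗ N)) (ΓM₁𝐭⇒ΓM₀𝐭 (M ⊗ K ⊗ N) MKN∈ , χMKN≡0)
    where
    M = mat⁺ g
    K = mat⁺ h
    N = mat⁻ g
    M∈ = proj₁ (ΓM₀𝐭⇒ΓM₁𝐭 g g∈)
    N∈ = proj₂ (ΓM₀𝐭⇒ΓM₁𝐭 g g∈)
    K∈ = proj₁ (ΓM₀𝐭⇒ΓM₁𝐭 h h∈𝐭)
    MK∈ = ΓM₁𝐭-⊗ M K M∈ K∈
    MKN∈ = ΓM₁𝐭-⊗ (M ⊗ K) N MK∈ N∈
    χMKN≡0 : χ (M ⊗ K ⊗ N) ≡ false
    χMKN≡0 = begin
      χ (M ⊗ K ⊗ N)             ≡⟨ χ-⊗ (M ⊗ K) N MK∈ N∈ ⟩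
      χ (M ⊗ K) xor χ N         ≡⟨ cong₂ _xor_ (χ-⊗ M K M∈ K∈) (χ-inverse g g∈) ⟩
      (χ M xor χ K) xor χ M     ≡⟨ cong (λ x → (χ M xor x) xor χ M) χh≡0 ⟩
      (χ M xor false) xor χ M   ≡⟨ cong (_xor χ M) (xor-identityʳ (χ M)) ⟩
      χ M xor χ M               ≡⟨ xor-same (χ M) ⟩
      false                     ∎

hasIndex-viaCosetInvariant : ∀ {H G : M2 → Set} {n} {A : Set} (Fin↔A : Fin n ↔ A) (κ : GL2 → A) →
  (∀ g g′ → G (mat⁺ g) → G (mat⁺ g′) → (κ g ≡ κ g′) ⇔ H (mat⁻ g ⊗ mat⁺ g′)) →
  (∀ x → ∃ λ g → G (mat⁺ g) × κ g ≡ x) →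
  HasIndex H G n
hasIndex-viaCosetInvariant {H} {G} Fin↔A κ κ≡⇔H onto = from′ ∘ κ , same-coset , hit
  where
  open Inverse Fin↔A using (strictlyInverseˡ; strictlyInverseʳ) renaming (to to to′; from to from′)
  from′-injective : ∀ {x y} → from′ x ≡ from′ y → x ≡ y
  from′-injective {x} {y} e = begin
    x                ≡⟨ strictlyInverseˡ x ⟨
    to′ (from′ x)    ≡⟨ cong to′ e ⟩
    to′ (from′ y)    ≡⟨ strictlyInverseˡ y ⟩
    y                ∎
  same-coset : ∀ g g′ → G (mat⁺ g) → G (mat⁺ g′) →
               (from′ (κ g) ≡ from′ (κ g′)) ⇔ H (mat⁻ g ⊗ mat⁺ g′)
  same-coset g g′ g∈ g′∈ =
    mk⇔ (to (κ≡⇔H g g′ g∈ g′∈) ∘ from′-injective) (cong from′ ∘ from (κ≡⇔H g g′ g∈ g′∈))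
  hit : ∀ i → ∃ λ g → G (mat⁺ g) × from′ (κ g) ≡ i
  hit i = let (g , g∈ , κg≡) = onto (to′ i) in g , g∈ , trans (cong from′ κg≡) (strictlyInverseʳ i)

lowerUnitriangular : Bool → GL2
lowerUnitriangular b = gl (L b) (L b) (involutive b) (involutive b)
  where
  L : Bool → M2
  L b = mat 1ₚ 0ₚ (false ∷ b ∷ []) 1ₚ
  involutive : ∀ b → L b ⊗ L b ≈ₘ I₂
  involutive false = refl ∷ [] , refl ∷ [] , refl ∷ refl ∷ [] , refl ∷ refl ∷ []
  involutive true  = refl ∷ [] , refl ∷ [] , refl ∷ refl ∷ [] , refl ∷ refl ∷ []

Γ₀𝐭²-index2 : HasIndex (ΓM₀ (𝐭 *ₚ 𝐭)) (ΓM₀ 𝐭) 2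
Γ₀𝐭²-index2 = hasIndex-viaCosetInvariant {ΓM₀ (𝐭 *ₚ 𝐭)} {ΓM₀ 𝐭} 2↔Bool (χ ∘ mat⁺) same-coset
  (λ b → lowerUnitriangular b
       , ΓM₁𝐭⇒ΓM₀𝐭 (mat⁺ (lowerUnitriangular b)) (unitriangular refl refl refl)
       , refl)
  where
  same-coset : ∀ g g′ → ΓM₀ 𝐭 (mat⁺ g) → ΓM₀ 𝐭 (mat⁺ g′) →
               (χ (mat⁺ g) ≡ χ (mat⁺ g′)) ⇔ ΓM₀ (𝐭 *ₚ 𝐭) (mat⁻ g ⊗ mat⁺ g′)
  same-coset g g′ g∈ g′∈ = mk⇔
    (λ e → from (ΓM₀𝐭²⇔ (N ⊗ M′)) (ΓM₁𝐭⇒ΓM₀𝐭 (N ⊗ M′) (ΓM₁𝐭-⊗ N M′ N∈ M′∈) ,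
                                    trans χNM′≡ (from xor≡false⇔≡ e)))
    (λ NM′∈ → to xor≡false⇔≡ (trans (sym χNM′≡) (proj₂ (to (ΓM₀𝐭²⇔ (N ⊗ M′)) NM′∈))))
    where
    N = mat⁻ g
    M′ = mat⁺ g′
    N∈ = proj₂ (ΓM₀𝐭⇒ΓM₁𝐭 g g∈)
    M′∈ = proj₁ (ΓM₀𝐭⇒ΓM₁𝐭 g′ g′∈)
    χNM′≡ : χ (N ⊗ M′) ≡ χ (mat⁺ g) xor χ M′
    χNM′≡ = trans (χ-⊗ N M′ N∈ M′∈) (cong (_xor χ M′) (χ-inverse g g∈))

lemma7p5 : IsSubgroupOfGL2 (ΓM₀ (𝐭 *ₚ 𝐭)) × IsSubgroupOfGL2 (ΓM₀ 𝐭)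
           × IsNormalIn (ΓM₀ (𝐭 *ₚ 𝐭)) (ΓM₀ 𝐭) × HasIndex (ΓM₀ (𝐭 *ₚ 𝐭)) (ΓM₀ 𝐭) 2
lemma7p5 = Γ₀𝐭²-isSubgroup , Γ₀𝐭-isSubgroup , Γ₀𝐭²-normal , Γ₀𝐭²-index2
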